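{- Let $t$ be a plain term with resources and implicit names such that $t:\ell$ is derivable in the $\mathcal{L}$-type system described in the context, for some list $\ell$ of ®-indices. Then $t$ is affine.
   Context: An ®-index is a pair $(n,\alpha)$ with $n\in\mathbb{N}$ and $\alpha$ a finite string over $\{0,1\}$ ($\varepsilon$ the empty string; $\alpha0,\alpha1$ denote $\alpha$ followed by $0$, resp. $1$). Plain terms: $t::=(n,\alpha)\mid\lambda t\mid t\,t\mid (n,\alpha)\odot t\mid (n,\alpha)\triangledown t$ (erasure and duplication). Strings of booleans are ordered lexicographically from $0<1$ with $\varepsilon$ below every nonempty string, and ®-indices by the lexicographic product: $(n_1,\alpha_1)<(n_2,\alpha_2)$ iff $n_1<n_2$, or $n_1=n_2$ and $\alpha_1<\alpha_2$. $\mathcal{L}$-types are finite lists of ®-indices. Partial merge $\ddagger$: $[]\ddagger\ell=\ell$; $(x::\ell)\ddagger[]=x::\ell$; $(x_1::\ell_1)\ddagger(x_2::\ell_2)=x_1::(\ell_1\ddagger(x_2::\ell_2))$ if $x_1<x_2$, $=x_2::((x_1::\ell_1)\ddagger\ell_2)$ if $x_2<x_1$, undefined when the recursion reaches equal heads. Partial decrement, defined only on lists whose elements all have strictly positive first component: $\downarrow[]=[]$, $\downarrow((n+1,\alpha)::\ell)=(n,\alpha)::\downarrow\ell$. Typing rules (applicable only when the conclusion's list is defined): (ind) $(n,\alpha):[(n,\alpha)]$; (abs) if $t:(0,\varepsilon)::\ell$ then $\lambda t:\downarrow\ell$; (app) if $t_1:\ell_1,t_2:\ell_2$ then $t_1t_2:\ell_1\ddagger\ell_2$;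 (era) if $t:\ell$ then $(n,\alpha)\odot t:[(n,\alpha)]\ddagger\ell$; (dup) if $t:\ell\ddagger[(n,\alpha0),(n,\alpha1)]$ then $(n,\alpha)\triangledown t:[(n,\alpha)]\ddagger\ell$. The multiset $FO(t)$ of free ®-index occurrences is: $FO((n,\alpha))=\{(n,\alpha)\}$; $FO(t_1t_2)=FO(t_1)\uplus FO(t_2)$; $FO(\lambda s)=\{(n,\alpha):(n+1,\alpha)\in FO(s)\}$ (with multiplicities; occurrences with first component $0$ are bound by the $\lambda$); $FO((n,\alpha)\odot s)=\{(n,\alpha)\}\uplus FO(s)$; $FO((n,\alpha)\triangledown s)=\{(n,\alpha)\}\uplus (FO(s)$ with all occurrences of $(n,\alpha0),(n,\alpha1)$ removed$)$. A term is affine if for every subterm $s$ of it, no ®-index occurs more than once in $FO(s)$. -}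

module Defs where

open import Data.Nat using (ℕ; zero; suc)
open import Data.Bool using (Bool; true; false)
open import Data.List using (List; []; _∷_; _++_; filter)
open import Data.Product using (_×_; _,_)
open import Data.Maybe using (Maybe; just; nothing)
open import Relation.Binary.PropositionalEquality using (_≡_)
open import Relation.Nullary using (¬_; Dec; yes; no)
open import Relation.Nullary.Decidable using (_×-dec_; ¬?)
open import Data.List.Relation.Unary.Unique.Propositional using (Unique)
import Data.Nat.Properties as ℕP
import Data.List.Properties as LP
import Data.Bool.Properties as BP
import Data.Product.Properties as PP

-- strings of booleans; false = 0, true = 1
Str : Set
Str = List Bool

Idx : Set
Idx = ℕ × Str

_≟I_ : (x y : Idx) → Dec (x ≡ y)
_≟I_ = PP.≡-dec ℕP._≟_ (LP.≡-dec BP._≟_)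

data Ord3 : Set where
  lt eq gt : Ord3

cmpB : Bool → Bool → Ord3
cmpB false false = eq
cmpB false true  = lt
cmpB true  false = gt
cmpB true  true  = eq

cmpS : Str → Str → Ord3
cmpS []      []      = eq
cmpS []      (_ ∷ _) = lt
cmpS (_ ∷ _) []      = gt
cmpS (a ∷ α) (b ∷ β) with cmpB a b
... | lt = lt
... | gt = gt
... | eq = cmpS α β

cmpN : ℕ → ℕ → Ord3
cmpN zero    zero    = eq
cmpN zero    (suc _) = lt
cmpN (suc _) zero    = gt
cmpN (suc m) (suc n) = cmpN m n

cmpI : Idx → Idx → Ord3
cmpI (m , α) (n , β) with cmpN m n
... | lt = lt
... | gt = gt
... | eq = cmpS α β

LType : Set
LType = List Idx

-- partial merge ‡ (nothing = undefined); fuel-free via nested recursion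
mutual
  merge : LType → LType → Maybe LType
  merge []        l  = just l
  merge (x ∷ l₁)  l₂ = mergeC x l₁ l₂

  mergeC : Idx → LType → LType → Maybe LType
  mergeC x l₁ []        = just (x ∷ l₁)
  mergeC x l₁ (y ∷ l₂) with cmpI x y
  ... | lt = consM x (merge l₁ (y ∷ l₂))
  ... | gt = consM y (mergeC x l₁ l₂)
  ... | eq = nothing

  consM : Idx → Maybe LType → Maybe LType
  consM x (just l) = just (x ∷ l)
  consM x nothing  = nothing

decr : LType → Maybe LType
decr []                   = just []
decr ((zero  , α) ∷ l)    = nothing
decr ((suc n , α) ∷ l) with decr l
... | just l' = just ((n , α) ∷ l')
... | nothing = nothing

data Term : Set where
  var : Idx → Term
  lam : Term → Term
  app : Term → Term → Term
  era : Idx → Term → Term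
  dup : Idx → Term → Term

data _∶_ : Term → LType → Set where
  ind : ∀ x → var x ∶ (x ∷ [])
  abs : ∀ {t l l'} → t ∶ ((0 , []) ∷ l) → decr l ≡ just l' → lam t ∶ l'
  ap  : ∀ {t₁ t₂ l₁ l₂ l} → t₁ ∶ l₁ → t₂ ∶ l₂ → merge l₁ l₂ ≡ just l → app t₁ t₂ ∶ l
  er  : ∀ {t l l'} x → t ∶ l → merge (x ∷ []) l ≡ just l' → era x t ∶ l'
  du  : ∀ {t l l₀ l'} n α → merge l ((n , α ++ (false ∷ [])) ∷ (n , α ++ (true ∷ [])) ∷ []) ≡ just l₀
      → t ∶ l₀ → merge ((n , α) ∷ []) l ≡ just l' → dup (n , α) t ∶ l'

unbind : List Idx → List Idx
unbind []                = []
unbind ((zero  , α) ∷ l) = unbind l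
unbind ((suc n , α) ∷ l) = (n , α) ∷ unbind l

FO : Term → List Idx
FO (var x)           = x ∷ []
FO (lam s)           = unbind (FO s)
FO (app s₁ s₂)       = FO s₁ ++ FO s₂
FO (era x s)         = x ∷ FO s
FO (dup (n , α) s)   =
  (n , α) ∷ filter (λ y → ¬? (y ≟I (n , α ++ (false ∷ [])))
                      ×-dec ¬? (y ≟I (n , α ++ (true ∷ [])))) (FO s)

data _⊑_ : Term → Term → Set where
  here  : ∀ {t} → t ⊑ t
  inLam : ∀ {s t} → s ⊑ t → s ⊑ lam t
  inAppˡ : ∀ {s t u} → s ⊑ t → s ⊑ app t u
  inAppʳ : ∀ {s t u} → s ⊑ u → s ⊑ app t u
  inEra : ∀ {s t x} → s ⊑ t → s ⊑ era x t
  inDup : ∀ {s t x} → s ⊑ t → s ⊑ dup x t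

Affine : Term → Set
Affine t = ∀ s → s ⊑ t → Unique (FO s)

-- Typing invariant: if t : ℓ then ℓ is strictly increasing and FO t is a
-- permutation of ℓ. Merging two increasing lists either fails on a common
-- element or interleaves them, decrementing is FO's unbinding of a λ, and
-- in t : ℓ ‡ [(n,α0),(n,α1)] the two indices removed by the filter of a
-- duplication are exactly the two appended ones, which do not occur in ℓ.
-- A strictly increasing list has no repetitions, and every subterm of a
-- typable term is typable, so each FO(s) is repetition-free.
module Submission where

open import Defs
open import Data.Bool using (true; false)
open import Data.List using (List; []; _∷_; _++_; filter)
open import Data.List.Properties using (++-identityʳ; filter-++; filter-all; filter-none)
open import Data.List.Relation.Unary.All as All using (All; []; _∷_)
open import Data.List.Relation.Unary.All.Properties using (++⁺; ++⁻ˡ; ++⁻ʳ)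
open import Data.List.Relation.Unary.AllPairs as AllPairs using (AllPairs; []; _∷_)
open import Data.List.Relation.Unary.Unique.Propositional using (Unique)
open import Data.List.Relation.Binary.Permutation.Propositional
  using (_↭_; refl; prep; swap; trans; ↭-sym; ↭⇒↭ₛ)
open import Data.List.Relation.Binary.Permutation.Propositional.Properties
  using (All-resp-↭; shift; filter-↭)
  renaming (++⁺ to ↭-++⁺)
import Data.List.Relation.Binary.Permutation.Setoid.Properties as ↭ₛ
open import Data.Maybe using (just)
open import Data.Nat using (zero; suc)
open import Data.Product using (Σ; _×_; _,_; proj₁; proj₂)
open import Function using (_∘_)
open import Level using (0ℓ)
open import Relation.Binary.PropositionalEquality
  using (_≡_; _≢_; refl; sym; cong; subst; setoid; module ≡-Reasoning)
open import Relation.Nullary using (¬_)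
open import Relation.Nullary.Decidable using (_×-dec_; ¬?)
open import Relation.Unary using (Pred; Decidable)

cmpS-refl : ∀ α → cmpS α α ≡ eq
cmpS-refl []          = refl
cmpS-refl (false ∷ α) = cmpS-refl α
cmpS-refl (true ∷ α)  = cmpS-refl α

cmpS-gt⇒lt : ∀ α β → cmpS α β ≡ gt → cmpS β α ≡ lt
cmpS-gt⇒lt (_ ∷ _)     []          _ = refl
cmpS-gt⇒lt (false ∷ α) (false ∷ β) e = cmpS-gt⇒lt α β e
cmpS-gt⇒lt (true ∷ α)  (false ∷ β) _ = refl
cmpS-gt⇒lt (true ∷ α)  (true ∷ β)  e = cmpS-gt⇒lt α β e

cmpS-lt-trans : ∀ α β γ → cmpS α β ≡ lt → cmpS β γ ≡ lt → cmpS α γ ≡ lt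
cmpS-lt-trans []          (_ ∷ _)     (_ ∷ _)     _ _ = refl
cmpS-lt-trans (false ∷ α) (false ∷ β) (false ∷ γ) p q = cmpS-lt-trans α β γ p q
cmpS-lt-trans (false ∷ α) (false ∷ β) (true ∷ γ)  _ _ = refl
cmpS-lt-trans (false ∷ α) (true ∷ β)  (true ∷ γ)  _ _ = refl
cmpS-lt-trans (true ∷ α)  (true ∷ β)  (true ∷ γ)  p q = cmpS-lt-trans α β γ p q

infix 4 _<I_

_<I_ : Idx → Idx → Set
x <I y = cmpI x y ≡ lt

cmpI-refl : ∀ x → cmpI x x ≡ eq
cmpI-refl (zero , α)  = cmpS-refl α
cmpI-refl (suc n , α) = cmpI-refl (n , α)

cmpI-gt⇒> : ∀ x y → cmpI x y ≡ gt → y <I x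
cmpI-gt⇒> (zero , α)  (zero , β)  e = cmpS-gt⇒lt α β e
cmpI-gt⇒> (suc m , α) (zero , β)  _ = refl
cmpI-gt⇒> (suc m , α) (suc n , β) e = cmpI-gt⇒> (m , α) (n , β) e

<I-trans : ∀ x y z → x <I y → y <I z → x <I z
<I-trans (zero , α)  (zero , β)  (zero , γ)  p q = cmpS-lt-trans α β γ p q
<I-trans (zero , α)  (zero , β)  (suc k , γ) _ _ = refl
<I-trans (zero , α)  (suc n , β) (suc k , γ) _ _ = refl
<I-trans (suc m , α) (suc n , β) (suc k , γ) p q = <I-trans (m , α) (n , β) (k , γ) p q

<I⇒≢ : ∀ {x y} → x <I y → x ≢ y
<I⇒≢ {x} x<x refl with subst (λ o → o ≡ lt) (cmpI-refl x) x<x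
... | ()

Sorted : LType → Set
Sorted = AllPairs _<I_

Sorted⇒Unique : ∀ {l} → Sorted l → Unique l
Sorted⇒Unique = AllPairs.map <I⇒≢

Unique-resp-↭ : ∀ {xs ys : List Idx} → xs ↭ ys → Unique xs → Unique ys
Unique-resp-↭ p = ↭ₛ.Unique-resp-↭ (setoid Idx) (↭⇒↭ₛ p)

Unique-++⇒disjoint : ∀ (xs ys : List Idx) → Unique (xs ++ ys) → All (λ x → All (x ≢_) ys) xs
Unique-++⇒disjoint []       ys _         = []
Unique-++⇒disjoint (x ∷ xs) ys (x∉ ∷ u) = ++⁻ʳ xs x∉ ∷ Unique-++⇒disjoint xs ys u

filter-++-all-none : ∀ {a p} {A : Set a} {P : Pred A p} (P? : Decidable P) {xs ys : List A} →
                     All P xs → All (¬_ ∘ P) ys → filter P? (xs ++ ys) ≡ xs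
filter-++-all-none P? {xs} {ys} all none = begin
  filter P? (xs ++ ys)          ≡⟨ filter-++ P? xs ys ⟩
  filter P? xs ++ filter P? ys  ≡⟨ cong (filter P? xs ++_) (filter-none P? none) ⟩
  filter P? xs ++ []            ≡⟨ ++-identityʳ _ ⟩
  filter P? xs                  ≡⟨ filter-all P? all ⟩
  xs                            ∎
  where open ≡-Reasoning

consM-just⁻ : ∀ {x m l} → consM x m ≡ just l → Σ LType λ l′ → m ≡ just l′ × l ≡ x ∷ l′
consM-just⁻ {m = just l′} refl = l′ , refl , refl

mutual
  merge-↭ : ∀ l₁ l₂ {l} → merge l₁ l₂ ≡ just l → l ↭ l₁ ++ l₂
  merge-↭ []       l₂ refl = refl
  merge-↭ (x ∷ l₁) l₂ e    = mergeC-↭ x l₁ l₂ e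

  mergeC-↭ : ∀ x l₁ l₂ {l} → mergeC x l₁ l₂ ≡ just l → l ↭ x ∷ l₁ ++ l₂
  mergeC-↭ x l₁ [] refl = subst (x ∷ l₁ ↭_) (sym (++-identityʳ (x ∷ l₁))) refl
  mergeC-↭ x l₁ (y ∷ l₂) e with cmpI x y
  ... | lt with consM-just⁻ e
  ...   | _ , e′ , refl = prep x (merge-↭ l₁ (y ∷ l₂) e′)
  mergeC-↭ x l₁ (y ∷ l₂) e | gt with consM-just⁻ e
  ...   | _ , e′ , refl = trans (prep y (mergeC-↭ x l₁ l₂ e′)) (↭-sym (shift y (x ∷ l₁) l₂))

mutual
  merge-Sorted⁺ : ∀ l₁ l₂ {l} → Sorted l₁ → Sorted l₂ → merge l₁ l₂ ≡ just l → Sorted l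
  merge-Sorted⁺ []       l₂ _  s₂ refl = s₂
  merge-Sorted⁺ (x ∷ l₁) l₂ s₁ s₂ e    = mergeC-Sorted⁺ x l₁ l₂ s₁ s₂ e

  mergeC-Sorted⁺ : ∀ x l₁ l₂ {l} → Sorted (x ∷ l₁) → Sorted l₂ → mergeC x l₁ l₂ ≡ just l → Sorted l
  mergeC-Sorted⁺ x l₁ [] s₁ _ refl = s₁
  mergeC-Sorted⁺ x l₁ (y ∷ l₂) s₁@(x<l₁ ∷ s₁′) s₂@(y<l₂ ∷ s₂′) e with cmpI x y in x<y
  ... | lt with consM-just⁻ e
  ...   | _ , e′ , refl =
    All-resp-↭ (↭-sym (merge-↭ l₁ (y ∷ l₂) e′)) (++⁺ x<l₁ (x<y ∷ All.map (<I-trans x y _ x<y) y<l₂))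
    ∷ merge-Sorted⁺ l₁ (y ∷ l₂) s₁′ s₂ e′
  mergeC-Sorted⁺ x l₁ (y ∷ l₂) s₁@(x<l₁ ∷ _) (y<l₂ ∷ s₂′) e | gt with consM-just⁻ e
  ...   | _ , e′ , refl =
    All-resp-↭ (↭-sym (mergeC-↭ x l₁ l₂ e′)) (y<x ∷ ++⁺ (All.map (<I-trans y x _ y<x) x<l₁) y<l₂)
    ∷ mergeC-Sorted⁺ x l₁ l₂ s₁ s₂′ e′
    where y<x = cmpI-gt⇒> x y x<y

mutual
  merge-Sorted⁻ˡ : ∀ l₁ l₂ {l} → merge l₁ l₂ ≡ just l → Sorted l → Sorted l₁
  merge-Sorted⁻ˡ []       l₂ _ _ = []
  merge-Sorted⁻ˡ (x ∷ l₁) l₂ e s = mergeC-Sorted⁻ˡ x l₁ l₂ e s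

  mergeC-Sorted⁻ˡ : ∀ x l₁ l₂ {l} → mergeC x l₁ l₂ ≡ just l → Sorted l → Sorted (x ∷ l₁)
  mergeC-Sorted⁻ˡ x l₁ [] refl s = s
  mergeC-Sorted⁻ˡ x l₁ (y ∷ l₂) e s with cmpI x y
  ... | lt with consM-just⁻ e | s
  ...   | _ , e′ , refl | x<l ∷ s′ =
    ++⁻ˡ l₁ (All-resp-↭ (merge-↭ l₁ (y ∷ l₂) e′) x<l) ∷ merge-Sorted⁻ˡ l₁ (y ∷ l₂) e′ s′
  mergeC-Sorted⁻ˡ x l₁ (y ∷ l₂) e s | gt with consM-just⁻ e | s
  ...   | _ , e′ , refl | _ ∷ s′ = mergeC-Sorted⁻ˡ x l₁ l₂ e′ s′

decr≡unbind : ∀ l {l′} → decr l ≡ just l′ → unbind l ≡ l′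
decr≡unbind []              refl = refl
decr≡unbind ((suc n , α) ∷ l) e with decr l in d
decr≡unbind ((suc n , α) ∷ l) refl | just _ = cong ((n , α) ∷_) (decr≡unbind l d)

decr-All : ∀ {P Q : Pred Idx 0ℓ} → (∀ n α → P (suc n , α) → Q (n , α)) →
           ∀ l {l′} → All P l → decr l ≡ just l′ → All Q l′
decr-All f []                []       refl = []
decr-All f ((suc n , α) ∷ l) (p ∷ ps) e    with decr l in d
decr-All f ((suc n , α) ∷ l) (p ∷ ps) refl | just _ = f n α p ∷ decr-All f l ps d

decr-Sorted : ∀ l {l′} → Sorted l → decr l ≡ just l′ → Sorted l′
decr-Sorted []                []      refl = []
decr-Sorted ((suc n , α) ∷ l) (x<l ∷ s) e    with decr l in d
decr-Sorted ((suc n , α) ∷ l) (x<l ∷ s) refl | just _ =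
  decr-All (λ _ _ x<y → x<y) l x<l d ∷ decr-Sorted l s d

unbind-↭ : ∀ {xs ys} → xs ↭ ys → unbind xs ↭ unbind ys
unbind-↭ refl                              = refl
unbind-↭ (prep (zero , α) p)               = unbind-↭ p
unbind-↭ (prep (suc n , α) p)              = prep (n , α) (unbind-↭ p)
unbind-↭ (swap (zero , α)  (zero , β) p)   = unbind-↭ p
unbind-↭ (swap (zero , α)  (suc m , β) p)  = prep (m , β) (unbind-↭ p)
unbind-↭ (swap (suc n , α) (zero , β) p)   = prep (n , α) (unbind-↭ p)
unbind-↭ (swap (suc n , α) (suc m , β) p)  = swap (n , α) (m , β) (unbind-↭ p)
unbind-↭ (trans p q)                       = trans (unbind-↭ p) (unbind-↭ q)

typed⇒Sorted : ∀ {t l} → t ∶ l → Sorted l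
typed⇒Sorted (ind x)                   = [] ∷ []
typed⇒Sorted (abs {l = l} d e)         = decr-Sorted l (AllPairs.tail (typed⇒Sorted d)) e
typed⇒Sorted (ap {l₁ = l₁} {l₂} d₁ d₂ e) = merge-Sorted⁺ l₁ l₂ (typed⇒Sorted d₁) (typed⇒Sorted d₂) e
typed⇒Sorted (er {l = l} x d e)        = merge-Sorted⁺ (x ∷ []) l ([] ∷ []) (typed⇒Sorted d) e
typed⇒Sorted (du {l = l} n α e₀ d e)   =
  merge-Sorted⁺ ((n , α) ∷ []) l ([] ∷ []) (merge-Sorted⁻ˡ l _ e₀ (typed⇒Sorted d)) e

typed⇒FO↭ : ∀ {t l} → t ∶ l → FO t ↭ l
typed⇒FO↭ (ind x)                     = refl
typed⇒FO↭ (abs {t} {l} d e)           =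
  subst (unbind (FO t) ↭_) (decr≡unbind l e) (unbind-↭ (typed⇒FO↭ d))
typed⇒FO↭ (ap {l₁ = l₁} {l₂} d₁ d₂ e) = trans (↭-++⁺ (typed⇒FO↭ d₁) (typed⇒FO↭ d₂)) (↭-sym (merge-↭ l₁ l₂ e))
typed⇒FO↭ (er {l = l} x d e)          = trans (prep x (typed⇒FO↭ d)) (↭-sym (merge-↭ (x ∷ []) l e))
typed⇒FO↭ (du {t} {l} {l₀} n α e₀ d e) =
  trans (prep (n , α) filtered) (↭-sym (merge-↭ ((n , α) ∷ []) l e))
  where
    x₀ = (n , α ++ (false ∷ []))
    x₁ = (n , α ++ (true ∷ []))
    fresh? = λ y → ¬? (y ≟I x₀) ×-dec ¬? (y ≟I x₁)
    l₀↭ : l₀ ↭ l ++ x₀ ∷ x₁ ∷ []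
    l₀↭ = merge-↭ l (x₀ ∷ x₁ ∷ []) e₀
    l-fresh : All (λ y → y ≢ x₀ × y ≢ x₁) l
    l-fresh = All.map (λ { (y≢x₀ ∷ y≢x₁ ∷ []) → y≢x₀ , y≢x₁ })
      (Unique-++⇒disjoint l _ (Unique-resp-↭ l₀↭ (Sorted⇒Unique (typed⇒Sorted d))))
    not-fresh : All (λ y → ¬ (y ≢ x₀ × y ≢ x₁)) (x₀ ∷ x₁ ∷ [])
    not-fresh = (λ f → proj₁ f refl) ∷ (λ f → proj₂ f refl) ∷ []
    filtered : filter fresh? (FO t) ↭ l
    filtered = subst (filter fresh? (FO t) ↭_) (filter-++-all-none fresh? l-fresh not-fresh)
                 (filter-↭ fresh? (trans (typed⇒FO↭ d) l₀↭))

subterm-typed : ∀ {s t l} → s ⊑ t → t ∶ l → Σ LType (s ∶_)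
subterm-typed here       d              = _ , d
subterm-typed (inLam q)  (abs d _)      = subterm-typed q d
subterm-typed (inAppˡ q) (ap d _ _)     = subterm-typed q d
subterm-typed (inAppʳ q) (ap _ d _)     = subterm-typed q d
subterm-typed (inEra q)  (er _ d _)     = subterm-typed q d
subterm-typed (inDup q)  (du _ _ _ d _) = subterm-typed q d

typed⇒Unique-FO : ∀ {t l} → t ∶ l → Unique (FO t)
typed⇒Unique-FO d = Unique-resp-↭ (↭-sym (typed⇒FO↭ d)) (Sorted⇒Unique (typed⇒Sorted d))

proposition4 : (t : Term) (l : LType) → t ∶ l → Affine t
proposition4 t l d s s⊑t = typed⇒Unique-FO (proj₂ (subterm-typed s⊑t d))
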